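{- Let $m$ be a natural number. For every infinite set $x\subset m^{<\omega}$ there exists an infinite subset $x'\subset x$ such that $x'$ is a $(u,v)$-comb for some pair $(u,v)\in m^2$.
   Context: $m^{<\omega}$ is the set of finite sequences of elements of $m=\{0,\dots,m-1\}$, ordered by initial segment ($s\le t$), with concatenation $s^\frown t$, $s^\frown i=s^\frown(i)$ and length $|s|$. For $u\in m$, a $u$-chain is an infinite set $\{s[0],s[1],\dots\}$ with $s[i]^\frown u\leq s[i+1]$ for all $i$. For $u\neq v$, a $(u,v)$-comb is an infinite set $\{t[0],t[1],\dots\}$ such that there is a $u$-chain $\{s[i]\}$ with $s[i]^\frown v\leq t[i]$ and $|t[i]|<|s[i+1]|$ for all $i$; a $(u,u)$-comb means a $u$-chain. -}

module Defs where

open import Data.Nat using (ℕ; suc; _<_)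
open import Data.Fin using (Fin; _≟_)
open import Data.List using (List; []; _∷_; _++_; [_]; length)
open import Data.List.Membership.Propositional using (_∈_)
open import Data.Product using (Σ; ∃; _×_; _,_)
open import Relation.Binary.PropositionalEquality using (_≡_; _≢_)
open import Relation.Nullary using (¬_)
open import Function.Bundles using (_⇔_)

Seq : ℕ → Set
Seq m = List (Fin m)

SeqSet : ℕ → Set₁
SeqSet m = Seq m → Set

_⌢_ : ∀ {m} → Seq m → Fin m → Seq m
s ⌢ i = s ++ [ i ]

_⊑_ : ∀ {m} → Seq m → Seq m → Set
s ⊑ t = ∃ λ r → s ++ r ≡ t

_⊆_ : ∀ {m} → SeqSet m → SeqSet m → Set
X ⊆ Y = ∀ s → X s → Y s

Finite : ∀ {m} → SeqSet m → Set
Finite {m} X = ∃ λ (l : List (Seq m)) → ∀ s → X s → s ∈ l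

Infinite : ∀ {m} → SeqSet m → Set
Infinite X = ¬ Finite X

IsRange : ∀ {m} → SeqSet m → (ℕ → Seq m) → Set
IsRange X f = ∀ y → X y ⇔ (∃ λ i → f i ≡ y)

ChainSeq : ∀ {m} → Fin m → (ℕ → Seq m) → Set
ChainSeq u s = ∀ i → (s i ⌢ u) ⊑ s (suc i)

IsChain : ∀ {m} → Fin m → SeqSet m → Set
IsChain u X = Infinite X × ∃ λ s → ChainSeq u s × IsRange X s

IsComb : ∀ {m} → Fin m → Fin m → SeqSet m → Set
IsComb u v X with u ≟ v
... | Relation.Nullary.yes _ = IsChain u X
... | Relation.Nullary.no _ =
  Infinite X × ∃ λ t → ∃ λ s → ChainSeq u s × IsRange X t ×
    (∀ i → (s i ⌢ v) ⊑ t i × length (t i) < length (s (suc i)))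

-- The argument is König's lemma followed by two Ramsey-style selections.
-- Call p "long above" in x if x has members of arbitrary length extending p.
-- The root [] is long above x because x is infinite, and by the infinite
-- pigeonhole principle every p that is long above x has a one-letter
-- extension that is again long above x.  This yields an infinite word c
-- whose prefixes are all long above x.
--   * If infinitely many prefixes of c lie in x, colour each by the letter of
--     c following it; infinitely many share a letter u, and picking those
--     prefixes at increasing levels gives a u-chain.
--   * Otherwise every member of x above a late prefix leaves the branch c at
--     some level j by a letter v ≢ c j.  Such "branch-offs" occur at
--     unboundedly many levels; colouring them by (c j , v) and picking
--     them with each level beyond the previous leaf gives a (u,v)-comb, u ≢ v.
module Submission where

open import Defs
open import Data.Nat using (ℕ; zero; suc; _+_; _≤_; _<_; _≤′_; ≤′-refl; ≤′-step; z≤n; s≤s)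
open import Data.Nat.Properties
  using (≤-refl; ≤-trans; <⇒≤; <-irrefl; ≤⇒≤′; ≰⇒≥; m≤m+n; m≤n+m; n≮n; ≤-<-trans;
         <-trans; +-suc; +-identityʳ; +-comm)
open import Data.Fin using (Fin; _≟_)
open import Data.List using (List; []; _∷_; _++_; [_]; length; map; concatMap; allFin; cartesianProduct)
open import Data.List.Extrema.Nat using (max; xs≤max)
open import Data.List.Properties using (length-++; ++-assoc; ++-identityʳ)
open import Data.List.Membership.Propositional using (_∈_; lose)
open import Data.List.Membership.Propositional.Properties
  using (∈-map⁺; ∈-concatMap⁺; ∈-allFin; ∈-cartesianProduct⁺)
open import Data.List.Relation.Unary.All as All using ()
open import Data.List.Relation.Unary.Any using (here; there)
open import Data.Product using (Σ; ∃; _×_; _,_; proj₁; proj₂)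
open import Data.Product.Properties using (,-injectiveˡ; ,-injectiveʳ)
open import Data.Sum as Sum using (_⊎_; inj₁; inj₂)
open import Data.Empty using (⊥-elim)
open import Relation.Nullary using (¬_; yes; no)
open import Relation.Binary.PropositionalEquality using (_≡_; _≢_; refl; sym; trans; cong; subst)
open import Function using (id)
open import Function.Bundles using (mk⇔)
open import Level using (0ℓ)
open import Axiom.ExcludedMiddle using (ExcludedMiddle)
open import Axiom.DoubleNegationElimination using (em⇒dne)

≤-max-map : {A : Set} (f : A → ℕ) {y : A} {l : List A} → y ∈ l → f y ≤ max 0 (map f l)
≤-max-map f {l = l} y∈l = All.lookup (xs≤max 0 (map f l)) (∈-map⁺ f y∈l)

Unbounded : (ℕ → Set) → Set
Unbounded P = ∀ n → Σ ℕ λ k → n ≤ k × P k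

module _ (em : ExcludedMiddle 0ℓ) where

  eventually-false : {P : ℕ → Set} → ¬ Unbounded P → Σ ℕ λ N → ∀ k → N ≤ k → ¬ P k
  eventually-false ¬unbounded =
    em⇒dne em λ ¬bound → ¬unbounded λ n →
      em⇒dne em λ ¬above → ¬bound (n , λ k n≤k pk → ¬above (k , n≤k , pk))

  pigeonhole : {C : Set} (colours : List C) → (∀ a → a ∈ colours) →
    {P : ℕ → Set} (colour : ∀ n → P n → C) → Unbounded P →
    Σ C λ a → Unbounded (λ n → Σ (P n) λ p → colour n p ≡ a)
  pigeonhole {C} colours complete {P} colour unbounded =
    em⇒dne em λ noClass →
      let bound : (a : C) → Σ ℕ λ N → ∀ n → N ≤ n → ¬ Σ (P n) λ p → colour n p ≡ a
          bound a = eventually-false (λ classUnbounded → noClass (a , classUnbounded))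
          (n , M≤n , p) = unbounded (max 0 (map (λ a → proj₁ (bound a)) colours))
          a = colour n p
      in proj₂ (bound a) n (≤-trans (≤-max-map (λ a → proj₁ (bound a)) (complete a)) M≤n) (p , refl)

record Enumeration (P : ℕ → Set) (reach : ∀ n → P n → ℕ) : Set where
  field
    index   : ℕ → ℕ
    witness : ∀ i → P (index i)
    beyond  : ∀ i → reach (index i) (witness i) < index (suc i)

module _ {P : ℕ → Set} (reach : ∀ n → P n → ℕ) where

  enumerate : Unbounded P → Enumeration P reach
  enumerate unbounded = record
    { index   = λ i → proj₁ (pick i)
    ; witness = λ i → proj₂ (pick i)
    ; beyond  = λ i → proj₁ (proj₂ (unbounded (suc (reach (proj₁ (pick i)) (proj₂ (pick i))))))
    }
    where
    above : ℕ → Σ ℕ P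
    above n = proj₁ (unbounded n) , proj₂ (proj₂ (unbounded n))

    pick : ℕ → Σ ℕ P
    pick zero    = above 0
    pick (suc i) = above (suc (reach (proj₁ (pick i)) (proj₂ (pick i))))

  index-≥ : (E : Enumeration P reach) → (∀ n p → n ≤ reach n p) →
    ∀ i → i ≤ Enumeration.index E i
  index-≥ E reach-≥ zero    = z≤n
  index-≥ E reach-≥ (suc i) =
    ≤-<-trans (≤-trans (index-≥ E reach-≥ i) (reach-≥ _ _)) (Enumeration.beyond E i)

module _ {m : ℕ} where

  ⊑-refl : (p : Seq m) → p ⊑ p
  ⊑-refl p = [] , ++-identityʳ p

  ⊑-trans : {p q t : Seq m} → p ⊑ q → q ⊑ t → p ⊑ t
  ⊑-trans {p} (r , refl) (r' , refl) = r ++ r' , sym (++-assoc p r r')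

  ⊑-length : {p t : Seq m} → p ⊑ t → length p ≤ length t
  ⊑-length {p} (r , refl) = subst (length p ≤_) (sym (length-++ p)) (m≤m+n (length p) (length r))

  ⌢-⊑-length : {p t : Seq m} {i : Fin m} → (p ⌢ i) ⊑ t → length p < length t
  ⌢-⊑-length {p} {t} {i} ext =
    subst (_≤ length t) (trans (length-++ p) (+-comm (length p) 1)) (⊑-length ext)

  next-letter : {p t : Seq m} → p ⊑ t → length p < length t → Σ (Fin m) λ i → (p ⌢ i) ⊑ t
  next-letter {p} ([] , refl) p<p++[] = ⊥-elim (<-irrefl (cong length (sym (++-identityʳ p))) p<p++[])
  next-letter {p} (i ∷ r , refl)  _   = i , r , ++-assoc p [ i ] r

  sequencesUpTo : ℕ → List (Seq m)
  sequencesUpTo zero    = [] ∷ []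
  sequencesUpTo (suc n) = [] ∷ concatMap (λ i → map (i ∷_) (sequencesUpTo n)) (allFin m)

  ∈-sequencesUpTo : ∀ n (s : Seq m) → length s ≤ n → s ∈ sequencesUpTo n
  ∈-sequencesUpTo zero    []      _         = here refl
  ∈-sequencesUpTo (suc n) []      _         = here refl
  ∈-sequencesUpTo (suc n) (i ∷ s) (s≤s |s|≤n) =
    there (∈-concatMap⁺ (λ j → map (j ∷_) (sequencesUpTo n))
      (lose (∈-allFin i) (∈-map⁺ (i ∷_) (∈-sequencesUpTo n s |s|≤n))))

  bounded-length-finite : (X : SeqSet m) (n : ℕ) → (∀ s → X s → length s ≤ n) → Finite X
  bounded-length-finite X n bounded = sequencesUpTo n , λ s s∈X → ∈-sequencesUpTo n s (bounded s s∈X)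

  Range : (ℕ → Seq m) → SeqSet m
  Range f y = ∃ λ i → f i ≡ y

  range-isRange : (f : ℕ → Seq m) → IsRange (Range f) f
  range-isRange f y = mk⇔ id id

  range-⊆ : {X : SeqSet m} (f : ℕ → Seq m) → (∀ i → X (f i)) → Range f ⊆ X
  range-⊆ f f∈X _ (i , refl) = f∈X i

  range-infinite : (f : ℕ → Seq m) → (∀ i → i ≤ length (f i)) → Infinite (Range f)
  range-infinite f grows (l , covers) =
    n≮n M (≤-trans (grows (suc M)) (≤-max-map length (covers (f (suc M)) (suc M , refl))))
    where
    M : ℕ
    M = max 0 (map length l)

  chain⇒comb : {u : Fin m} {X : SeqSet m} → IsChain u X → IsComb u u X
  chain⇒comb {u} chain with u ≟ u
  ... | yes _   = chain
  ... | no u≢u  = ⊥-elim (u≢u refl)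

  comb-of-distinct : {u v : Fin m} {X : SeqSet m} → u ≢ v →
    (Infinite X × ∃ λ t → ∃ λ s → ChainSeq u s × IsRange X t ×
      (∀ i → (s i ⌢ v) ⊑ t i × length (t i) < length (s (suc i)))) → IsComb u v X
  comb-of-distinct {u} {v} u≢v comb with u ≟ v
  ... | yes u≡v = ⊥-elim (u≢v u≡v)
  ... | no _    = comb

  HasCombSubset : SeqSet m → Set₁
  HasCombSubset x = ∃ λ (x' : SeqSet m) → x' ⊆ x × Infinite x' ×
    ∃ λ (u : Fin m) → ∃ λ (v : Fin m) → IsComb u v x'

  prefix : (ℕ → Fin m) → ℕ → Seq m
  prefix c zero    = []
  prefix c (suc k) = prefix c k ⌢ c k

module _ {m : ℕ} (c : ℕ → Fin m) where

  prefix-length : ∀ k → length (prefix c k) ≡ k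
  prefix-length zero    = refl
  prefix-length (suc k) = trans (length-++ (prefix c k)) (trans (+-comm _ 1) (cong suc (prefix-length k)))

  prefix-mono : {j k : ℕ} → j ≤ k → prefix c j ⊑ prefix c k
  prefix-mono j≤k = go (≤⇒≤′ j≤k)
    where
    go : {j k : ℕ} → j ≤′ k → prefix c j ⊑ prefix c k
    go ≤′-refl          = ⊑-refl _
    go (≤′-step j≤′k)   = ⊑-trans (go j≤′k) ([ c _ ] , refl)

  leave-branch : ∀ k r →
    prefix c k ++ r ≡ prefix c (k + length r) ⊎
    Σ ℕ λ j → Σ (Fin m) λ v → k ≤ j × (prefix c j ⌢ v) ⊑ (prefix c k ++ r) × v ≢ c j
  leave-branch k [] = inj₁ (trans (++-identityʳ _) (cong (prefix c) (sym (+-identityʳ k))))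
  leave-branch k (a ∷ r) with a ≟ c k
  ... | no a≢ck = inj₂ (k , a , ≤-refl , (r , ++-assoc (prefix c k) [ a ] r) , a≢ck)
  ... | yes refl =
    Sum.map
      (λ continues → trans (sym shift) (trans continues (cong (prefix c) (sym (+-suc k (length r))))))
      (λ (j , v , k<j , leaves , v≢cj) →
         j , v , <⇒≤ k<j , subst ((prefix c j ⌢ v) ⊑_) shift leaves , v≢cj)
      (leave-branch (suc k) r)
    where
    shift : prefix c (suc k) ++ r ≡ prefix c k ++ (c k ∷ r)
    shift = ++-assoc (prefix c k) [ c k ] r

königs-lemma : {m : ℕ} (Good : Seq m → Set) → Good [] →
  (∀ p → Good p → Σ (Fin m) λ i → Good (p ⌢ i)) →
  Σ (ℕ → Fin m) λ c → ∀ k → Good (prefix c k)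
königs-lemma {m} Good root child = letter , λ k → subst Good (sym (prefix-node k)) (proj₂ (node k))
  where
  node : ℕ → Σ (Seq m) Good
  node zero    = [] , root
  node (suc k) = let (i , good) = child (proj₁ (node k)) (proj₂ (node k)) in proj₁ (node k) ⌢ i , good

  letter : ℕ → Fin m
  letter k = proj₁ (child (proj₁ (node k)) (proj₂ (node k)))

  prefix-node : ∀ k → prefix letter k ≡ proj₁ (node k)
  prefix-node zero    = refl
  prefix-node (suc k) = cong (_⌢ letter k) (prefix-node k)

LongAbove : {m : ℕ} → SeqSet m → Seq m → Set
LongAbove {m} x p = ∀ n → Σ (Seq m) λ t → x t × p ⊑ t × n ≤ length t

module _ (em : ExcludedMiddle 0ℓ) {m : ℕ} (x : SeqSet m) where

  long-above-root : Infinite x → LongAbove x []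
  long-above-root infinite n =
    em⇒dne em λ noLong → infinite (bounded-length-finite x n λ s s∈x →
      ≰⇒≥ λ n≤|s| → noLong (s , s∈x , (s , refl) , n≤|s|))

  long-above-step : {p : Seq m} → LongAbove x p → Σ (Fin m) λ i → LongAbove x (p ⌢ i)
  long-above-step {p} long = proj₁ coloured , λ n → continue n (proj₂ coloured n)
    where
    Continuation : ℕ → Set
    Continuation n = Σ (Seq m) λ t → Σ (Fin m) λ i → x t × (p ⌢ i) ⊑ t × n ≤ length t

    continuations : Unbounded Continuation
    continuations n with long (suc (length p) + n)
    ... | t , t∈x , p⊑t , long-enough =
      let (i , extends) = next-letter p⊑t (≤-trans (m≤m+n (suc (length p)) n) long-enough)
      in n , ≤-refl , t , i , t∈x , extends , ≤-trans (m≤n+m n (suc (length p))) long-enough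

    coloured : Σ (Fin m) λ j → Unbounded (λ n → Σ (Continuation n) λ q → proj₁ (proj₂ q) ≡ j)
    coloured = pigeonhole em (allFin m) ∈-allFin (λ _ q → proj₁ (proj₂ q)) continuations

    continue : ∀ n → (Σ ℕ λ k → n ≤ k × Σ (Continuation k) λ q → proj₁ (proj₂ q) ≡ proj₁ coloured) →
      Σ (Seq m) λ t → x t × (p ⌢ proj₁ coloured) ⊑ t × n ≤ length t
    continue n (k , n≤k , (t , _ , t∈x , extends , k≤|t|) , refl) =
      t , t∈x , extends , ≤-trans n≤k k≤|t|

module _ (em : ExcludedMiddle 0ℓ) {m : ℕ} {x : SeqSet m} (c : ℕ → Fin m) where

  chain-on-branch : Unbounded (λ k → x (prefix c k)) → HasCombSubset x
  chain-on-branch onBranch =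
    Range s , range-⊆ s (λ i → proj₁ (witness i)) , infinite , u , u ,
    chain⇒comb (infinite , s , chain , range-isRange s)
    where
    coloured : Σ (Fin m) λ u → Unbounded (λ k → Σ (x (prefix c k)) λ _ → c k ≡ u)
    coloured = pigeonhole em (allFin m) ∈-allFin (λ k _ → c k) onBranch

    u : Fin m
    u = proj₁ coloured

    E : Enumeration (λ k → Σ (x (prefix c k)) λ _ → c k ≡ u) (λ k _ → k)
    E = enumerate (λ k _ → k) (proj₂ coloured)
    open Enumeration E

    s : ℕ → Seq m
    s i = prefix c (index i)

    infinite : Infinite (Range s)
    infinite = range-infinite s λ i →
      subst (i ≤_) (sym (prefix-length c (index i))) (index-≥ (λ k _ → k) E (λ _ _ → ≤-refl) i)

    chain : ChainSeq u s
    chain i = subst (λ a → (s i ⌢ a) ⊑ s (suc i)) (proj₂ (witness i)) (prefix-mono c (beyond i))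

  record BranchOff (j : ℕ) : Set where
    field
      leaf     : Seq m
      exit     : Fin m
      leaf∈x   : x leaf
      exits    : (prefix c j ⌢ exit) ⊑ leaf
      deviates : exit ≢ c j

  open BranchOff

  branch-off-length : {j : ℕ} (o : BranchOff j) → j < length (leaf o)
  branch-off-length {j} o = subst (_< length (leaf o)) (prefix-length c j) (⌢-⊑-length (exits o))

  branch-offs : (∀ k → LongAbove x (prefix c k)) →
    (N : ℕ) → (∀ k → N ≤ k → ¬ x (prefix c k)) → Unbounded BranchOff
  branch-offs long N avoid n with long (n + N) 0
  ... | _ , t∈x , (r , refl) , _ with leave-branch c (n + N) r
  ...   | inj₁ onBranch =
    ⊥-elim (avoid (n + N + length r) (≤-trans (m≤n+m N n) (m≤m+n (n + N) (length r)))
                  (subst x onBranch t∈x))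
  ...   | inj₂ (j , v , n+N≤j , exits , v≢cj) =
    j , ≤-trans (m≤m+n n N) n+N≤j , record { leaf∈x = t∈x ; exits = exits ; deviates = v≢cj }

  comb-off-branch : Unbounded BranchOff → HasCombSubset x
  comb-off-branch offs =
    Range t , range-⊆ t (λ i → leaf∈x (off i)) , infinite , u , v ,
    comb-of-distinct u≢v (infinite , t , s , chain , range-isRange t , comb)
    where
    Coloured : Fin m × Fin m → ℕ → Set
    Coloured uv j = Σ (BranchOff j) λ o → (c j , exit o) ≡ uv

    coloured : Σ (Fin m × Fin m) λ uv → Unbounded (Coloured uv)
    coloured = pigeonhole em (cartesianProduct (allFin m) (allFin m))
      (λ (a , b) → ∈-cartesianProduct⁺ (∈-allFin a) (∈-allFin b)) (λ j o → c j , exit o) offs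

    u v : Fin m
    u = proj₁ (proj₁ coloured)
    v = proj₂ (proj₁ coloured)

    reach : ∀ j → Coloured (u , v) j → ℕ
    reach j (o , _) = length (leaf o)

    E : Enumeration (Coloured (u , v)) reach
    E = enumerate reach (proj₂ coloured)
    open Enumeration E

    off : ∀ i → BranchOff (index i)
    off i = proj₁ (witness i)

    s t : ℕ → Seq m
    s i = prefix c (index i)
    t i = leaf (off i)

    stem-colour : ∀ i → c (index i) ≡ u
    stem-colour i = ,-injectiveˡ (proj₂ (witness i))

    exit-colour : ∀ i → exit (off i) ≡ v
    exit-colour i = ,-injectiveʳ (proj₂ (witness i))

    u≢v : u ≢ v
    u≢v u≡v = deviates (off 0) (trans (exit-colour 0) (trans (sym u≡v) (sym (stem-colour 0))))

    infinite : Infinite (Range t)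
    infinite = range-infinite t λ i →
      <⇒≤ (≤-<-trans (index-≥ reach E (λ _ (o , _) → <⇒≤ (branch-off-length o)) i)
                     (branch-off-length (off i)))

    chain : ChainSeq u s
    chain i = subst (λ a → (s i ⌢ a) ⊑ s (suc i)) (stem-colour i)
      (prefix-mono c (<-trans (branch-off-length (off i)) (beyond i)))

    comb : ∀ i → (s i ⌢ v) ⊑ t i × length (t i) < length (s (suc i))
    comb i = subst (λ a → (s i ⌢ a) ⊑ t i) (exit-colour i) (exits (off i)) ,
             subst (length (t i) <_) (sym (prefix-length c (index (suc i)))) (beyond i)

  comb-near-branch : (∀ k → LongAbove x (prefix c k)) → HasCombSubset x
  comb-near-branch long with em {Unbounded (λ k → x (prefix c k))}
  ... | yes onBranch = chain-on-branch onBranch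
  ... | no offBranch =
    let (N , avoid) = eventually-false em offBranch
    in comb-off-branch (branch-offs long N avoid)

mainTheorem4 : ExcludedMiddle 0ℓ →
    (m : ℕ) (x : SeqSet m) → Infinite x →
    ∃ λ (x' : SeqSet m) → x' ⊆ x × Infinite x' ×
      ∃ λ (u : Fin m) → ∃ λ (v : Fin m) → IsComb u v x'
mainTheorem4 em m x infinite =
  let (c , long) = königs-lemma (LongAbove x) (long-above-root em x infinite) (λ _ → long-above-step em x)
  in comb-near-branch em c long
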